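{- Let $(\alpha_1,\dots,\alpha_n;\beta_1,\dots,\beta_{n-1})$ be admissible rational hypergeometric parameters, let $p$ be a good prime for them, and let $A_m$ be the $m$-th coefficient of ${}_nF_{n-1}(\alpha_1,\dots,\alpha_n;\beta_1,\dots,\beta_{n-1};z)$. Then $\sup_m v_p(A_m)=\infty$. In particular, for any given admissible parameters, $\sup_m v_p(A_m)=\infty$ for all but finitely many primes $p$.
   Context: ${}_nF_{n-1}(\alpha_1,\dots,\alpha_n;\beta_1,\dots,\beta_{n-1};z)=\sum_{m\ge0}\frac{\prod_{j}(\alpha_j)_m}{\prod_{k}(\beta_k)_m}\frac{z^m}{m!}$, where $(a)_0=1$ and $(a)_m=a(a+1)\cdots(a+m-1)$. $v_p$ is the $p$-adic valuation. Parameters are admissible if $0<\alpha_j,\beta_k<1$ for all $j,k$ and $\alpha_j\ne\beta_k$ for all $j,k$. A prime $p$ is good if $v_p(\alpha_j-1)=v_p(\beta_k-1)=0$ for all $j,k$. -}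

module Defs where

open import Data.Nat as ℕ using (ℕ; zero; suc)
open import Data.Nat.Divisibility using (_∣?_)
open import Data.Nat.DivMod using (_/_)
open import Data.Integer as ℤ using (ℤ; +_; _⊖_)
open import Data.Rational as ℚ using (ℚ; 0ℚ; 1ℚ; ↥_; ↧ₙ_; 1/_; ≢-nonZero)
open import Data.Rational.Properties using (_≟_)
open import Data.Fin using (Fin; zero; suc)
open import Data.Product using (_×_)
open import Relation.Nullary using (yes; no; ¬_)
open import Relation.Binary.PropositionalEquality using (_≢_; _≡_)

ℕ→ℚ : ℕ → ℚ
ℕ→ℚ m = (+ m) ℚ./ 1

poch : ℚ → ℕ → ℚ
poch a zero    = 1ℚ
poch a (suc m) = poch a m ℚ.* (a ℚ.+ ℕ→ℚ m)

factℚ : ℕ → ℚ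
factℚ zero    = 1ℚ
factℚ (suc m) = factℚ m ℚ.* ℕ→ℚ (suc m)

prodFin : ∀ {r} → (Fin r → ℚ) → ℚ
prodFin {zero}  f = 1ℚ
prodFin {suc r} f = f zero ℚ.* prodFin (λ i → f (suc i))

-- total inverse (1/0 := 0; only ever applied to nonzero values below)
inv : ℚ → ℚ
inv q with q ≟ 0ℚ
... | yes _ = 0ℚ
... | no q≢0 = 1/_ q {{≢-nonZero q≢0}}

-- m-th coefficient of nF_{n-1}(α_1..α_n; β_1..β_{n-1}; z), n = suc r
coeff : ∀ {r} → (Fin (suc r) → ℚ) → (Fin r → ℚ) → ℕ → ℚ
coeff α β m =
  prodFin (λ j → poch (α j) m) ℚ.* inv (prodFin (λ k → poch (β k) m) ℚ.* factℚ m)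

-- p-adic valuation of a natural number (for p ≥ 2, n ≥ 1), computed with fuel
vℕ-go : ℕ → ℕ → ℕ → ℕ
vℕ-go zero    k n = 0
vℕ-go (suc f) k zero = 0
vℕ-go (suc f) k (suc n) with suc (suc k) ∣? suc n
... | yes _ = suc (vℕ-go f k (suc n / suc (suc k)))
... | no  _ = 0

vℕ : ℕ → ℕ → ℕ
vℕ zero          n = 0
vℕ (suc zero)    n = 0
vℕ (suc (suc k)) n = vℕ-go n k n

-- p-adic valuation of a nonzero rational (value at 0 is a dummy 0)
vℚ : ℕ → ℚ → ℤ
vℚ p q = vℕ p ℤ.∣ ↥ q ∣ ⊖ vℕ p (↧ₙ q)

Admissible : ∀ {r} → (Fin (suc r) → ℚ) → (Fin r → ℚ) → Set
Admissible α β =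
  (∀ j → (0ℚ ℚ.< α j) × (α j ℚ.< 1ℚ)) ×
  (∀ k → (0ℚ ℚ.< β k) × (β k ℚ.< 1ℚ)) ×
  (∀ j k → α j ≢ β k)

Good : ∀ {r} → ℕ → (Fin (suc r) → ℚ) → (Fin r → ℚ) → Set
Good p α β =
  (∀ j → vℚ p (α j ℚ.- 1ℚ) ≡ + 0) × (∀ k → vℚ p (β k ℚ.- 1ℚ) ≡ + 0)

module Submission where

open import Defs
open import Data.Nat using (ℕ; suc; _≤_)
open import Data.Nat.Primality using (Prime)
open import Data.Integer as ℤ using (+_)
open import Data.Rational using (ℚ)
open import Data.Fin using (Fin)
open import Data.Product using (_×_; ∃-syntax)

open import Data.Nat
open import Data.Nat.Properties
open import Data.Nat.Divisibility
open import Data.Nat.DivMod using (_/_; _%_; m*n/n≡m; m%n<n; m≡m%n+[m/n]*n)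
open import Data.Nat.Induction using (<-rec)
open import Data.Nat.GCD using (gcd; module Bézout)
open import Data.Nat.Primality using (euclidsLemma; prime⇒irreducible; prime⇒nonTrivial)
open import Data.Nat.Solver using (module +-*-Solver)
open import Data.Product using (Σ; _,_; proj₁; proj₂)
open import Data.Sum using (inj₁; inj₂)
open import Data.Empty using (⊥; ⊥-elim)
open import Function.Base using (id; _∘_)
open import Function.Bundles using (_⇔_; mk⇔; Equivalence)
open import Relation.Nullary using (¬_; yes; no)
open import Relation.Binary using (tri<; tri≈; tri>)
open import Relation.Binary.PropositionalEquality
open import Data.Nat.Coprimality using (Coprime; 1-coprimeTo; coprime-Bézout)
  renaming (recompute to recompute-coprime; sym to coprime-sym)
open import Data.Integer using (ℤ; _⊖_; ∣_∣; +[1+_]; -[1+_])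
import Data.Integer.Properties as ℤP
open import Data.Integer.Solver using () renaming (module +-*-Solver to ℤ-Solver)
open import Data.Rational as ℚ using (mkℚ; ↥_; ↧_; ↧ₙ_; 0ℚ; 1ℚ; Positive; NonNegative)
import Data.Rational.Properties as ℚP
open import Data.Fin using (zero; suc)
open import Algebra.Properties.CommutativeMonoid.Sum +-0-commutativeMonoid using (sum; ∑-distrib-+)

-- Fix a prime p and write each parameter as x = a/b in lowest
-- terms.  Goodness makes p ∤ b, so v_p((x)_m) = ∑_{j<m} v_p(a + j b).  The key
-- counting lemma (module Counting) evaluates this sum along m = p^K: exactly
-- one residue class mod p of indices j has p ∣ a + j b, and dividing those terms
-- by p yields a new progression, so by induction on K
--     ∑_{j < p^K} v_p(a + j b) = (1 + p + ⋯ + p^(K-1)) + v_p(a')   with 1 ≤ a' ≤ b.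
-- At the index m = p^K - 1 the dropped last term a + (p^K - 1) b is prime to p,
-- so every numerator parameter contributes at least G = 1 + ⋯ + p^(K-1), every
-- denominator parameter at most G + b, and m! (a = b = 1) exactly G - K.  With
-- n numerator and n - 1 denominator parameters, v_p(A_m) ≥ K - ∑ b_k, which
-- is unbounded in K.  Finally, a prime larger than the numerators and
-- denominators of all x - 1 is automatically good.

sumTo : ℕ → (ℕ → ℕ) → ℕ
sumTo zero    f = 0
sumTo (suc m) f = sumTo m f + f m

sumTo-cong : ∀ m {f g} → (∀ j → j < m → f j ≡ g j) → sumTo m f ≡ sumTo m g
sumTo-cong zero    f≗g = refl
sumTo-cong (suc m) f≗g = cong₂ _+_ (sumTo-cong m (λ j j<m → f≗g j (m<n⇒m<1+n j<m))) (f≗g m ≤-refl)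

sumTo-++ : ∀ m n f → sumTo (m + n) f ≡ sumTo m f + sumTo n (λ j → f (m + j))
sumTo-++ m zero    f = trans (cong (λ x → sumTo x f) (+-identityʳ m)) (sym (+-identityʳ _))
sumTo-++ m (suc n) f = begin
  sumTo (m + suc n) f                                  ≡⟨ cong (λ x → sumTo x f) (+-suc m n) ⟩
  sumTo (m + n) f + f (m + n)                          ≡⟨ cong (_+ f (m + n)) (sumTo-++ m n f) ⟩
  sumTo m f + sumTo n (λ j → f (m + j)) + f (m + n)    ≡⟨ +-assoc (sumTo m f) _ _ ⟩
  sumTo m f + sumTo (suc n) (λ j → f (m + j))          ∎
  where open ≡-Reasoning

sumTo-blocks : ∀ M p f → sumTo (M * p) f ≡ sumTo M (λ t → sumTo p (λ r → f (t * p + r)))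
sumTo-blocks zero    p f = refl
sumTo-blocks (suc M) p f = begin
  sumTo (p + M * p) f                                   ≡⟨ cong (λ x → sumTo x f) (+-comm p (M * p)) ⟩
  sumTo (M * p + p) f                                   ≡⟨ sumTo-++ (M * p) p f ⟩
  sumTo (M * p) f + sumTo p (λ r → f (M * p + r))       ≡⟨ cong (_+ sumTo p (λ r → f (M * p + r))) (sumTo-blocks M p f) ⟩
  sumTo (suc M) (λ t → sumTo p (λ r → f (t * p + r)))   ∎
  where open ≡-Reasoning

sumTo-single : ∀ n f r₀ → r₀ < n → (∀ r → r < n → r ≢ r₀ → f r ≡ 0) → sumTo n f ≡ f r₀
sumTo-single (suc n) f r₀ r₀<1+n others with r₀ ≟ n
... | yes refl = cong (_+ f n) (vanishes n ≤-refl)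
  where
  vanishes : ∀ m → m ≤ n → sumTo m f ≡ 0
  vanishes zero    _   = refl
  vanishes (suc m) m<n =
    cong₂ _+_ (vanishes m (<⇒≤ m<n)) (others m (m<n⇒m<1+n m<n) (<⇒≢ m<n))
... | no r₀≢n = begin
  sumTo n f + f n   ≡⟨ cong (λ x → sumTo n f + x) (others n ≤-refl (≢-sym r₀≢n)) ⟩
  sumTo n f + 0     ≡⟨ +-identityʳ _ ⟩
  sumTo n f         ≡⟨ sumTo-single n f r₀ r₀<n (λ r r<n → others r (m<n⇒m<1+n r<n)) ⟩
  f r₀              ∎
  where
  open ≡-Reasoning
  r₀<n : r₀ < n
  r₀<n = ≤∧≢⇒< (≤-pred r₀<1+n) r₀≢n

sumTo-suc : ∀ M g → sumTo M (λ t → suc (g t)) ≡ M + sumTo M g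
sumTo-suc zero    g = refl
sumTo-suc (suc M) g = begin
  sumTo M (λ t → suc (g t)) + suc (g M)   ≡⟨ cong (_+ suc (g M)) (sumTo-suc M g) ⟩
  M + sumTo M g + suc (g M)               ≡⟨ solve 3 (λ m s x → m :+ s :+ (con 1 :+ x) := con 1 :+ m :+ (s :+ x)) refl M (sumTo M g) (g M) ⟩
  suc M + (sumTo M g + g M)               ∎
  where
  open ≡-Reasoning
  open +-*-Solver

sum-mono-≤ : ∀ {n} (f g : Fin n → ℕ) → (∀ i → f i ≤ g i) → sum f ≤ sum g
sum-mono-≤ {zero}  f g f≤g = z≤n
sum-mono-≤ {suc n} f g f≤g = +-mono-≤ (f≤g zero) (sum-mono-≤ (λ i → f (suc i)) (λ i → g (suc i)) (λ i → f≤g (suc i)))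

≤-sum : ∀ {n} (f : Fin n → ℕ) i → f i ≤ sum f
≤-sum f zero    = m≤m+n (f zero) _
≤-sum f (suc i) = ≤-trans (≤-sum (λ j → f (suc j)) i) (m≤n+m _ (f zero))

-- The p-adic valuation of positive naturals, for a prime p = k + 2 (this is the
-- shape on which `vℕ` computes).  Everything follows from the characterisation
-- `vℕ-exact`: if N = p^e · u with p ∤ u then vℕ p N = e.
module PAdic (k : ℕ) (prime-P : Prime (suc (suc k))) where

  P : ℕ
  P = suc (suc k)

  P≢1 : P ≢ 1
  P≢1 ()

  P∤1 : ¬ (P ∣ 1)
  P∤1 = P≢1 ∘ ∣1⇒≡1

  P∤⇒pos : ∀ {u} → ¬ (P ∣ u) → 1 ≤ u
  P∤⇒pos {zero}  P∤0 = ⊥-elim (P∤0 (P ∣0))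
  P∤⇒pos {suc u} _   = s≤s z≤n

  P∣P^e* : ∀ e u → 1 ≤ e → P ∣ P ^ e * u
  P∣P^e* (suc e) u _ = ∣m⇒∣m*n u (m∣m*n (P ^ e))

  -- Needed to see that the fuel N in `vℕ P N` suffices.
  e<P^e : ∀ e → e < P ^ e
  e<P^e zero    = s≤s z≤n
  e<P^e (suc e) = +-mono-≤ (m^n>0 P e) (≤-trans (e<P^e e) (m≤m+n _ _))

  vℕ-go-exact : ∀ fuel e N u → N ≡ P ^ e * u → ¬ (P ∣ u) → e ≤ fuel → vℕ-go fuel k N ≡ e
  vℕ-go-exact zero .zero N u _ _ z≤n = refl
  vℕ-go-exact (suc fuel) e zero u N≡ P∤u _ with m*n≡0⇒m≡0∨n≡0 (P ^ e) (sym N≡)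
  ... | inj₁ P^e≡0 = ⊥-elim (≢-nonZero⁻¹ _ {{m^n≢0 P e}} P^e≡0)
  ... | inj₂ refl  = ⊥-elim (P∤u (P ∣0))
  vℕ-go-exact (suc fuel) e (suc n) u N≡ P∤u e≤ with P ∣? suc n
  vℕ-go-exact (suc fuel) zero    (suc n) u N≡ P∤u _ | yes P∣N =
    ⊥-elim (P∤u (subst (P ∣_) (trans N≡ (*-identityˡ u)) P∣N))
  vℕ-go-exact (suc fuel) (suc e) (suc n) u N≡ P∤u (s≤s e≤) | yes _ =
    cong suc (vℕ-go-exact fuel e (suc n / P) u (trans (cong (_/ P) N≡) P^[1+e]u/P) P∤u e≤)
    where
    P^[1+e]u/P : P ^ suc e * u / P ≡ P ^ e * u
    P^[1+e]u/P = trans (cong (_/ P) (trans (*-assoc P (P ^ e) u) (*-comm P (P ^ e * u))))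
                       (m*n/n≡m (P ^ e * u) P)
  vℕ-go-exact (suc fuel) zero    (suc n) u N≡ P∤u _ | no _ = refl
  vℕ-go-exact (suc fuel) (suc e) (suc n) u N≡ P∤u _ | no P∤N =
    ⊥-elim (P∤N (subst (P ∣_) (sym N≡) (P∣P^e* (suc e) u (s≤s z≤n))))

  vℕ-exact : ∀ e u N → N ≡ P ^ e * u → ¬ (P ∣ u) → vℕ P N ≡ e
  vℕ-exact e u N N≡ P∤u = vℕ-go-exact N e N u N≡ P∤u e≤N
    where
    e≤N : e ≤ N
    e≤N = ≤-trans (<⇒≤ (e<P^e e))
            (≤-trans (m≤m*n (P ^ e) u {{>-nonZero (P∤⇒pos P∤u)}}) (≤-reflexive (sym N≡)))

  Split : ℕ → Set
  Split N = Σ ℕ λ e → Σ ℕ λ u → (N ≡ P ^ e * u) × ¬ (P ∣ u)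

  split : ∀ N → 1 ≤ N → Split N
  split = <-rec (λ N → 1 ≤ N → Split N) step
    where
    step : ∀ N → (∀ {M} → M < N → 1 ≤ M → Split M) → 1 ≤ N → Split N
    step N rec N≥1 with P ∣? N
    ... | no P∤N = 0 , N , sym (*-identityˡ N) , P∤N
    ... | yes P∣N@(divides q N≡qP) with rec (quotient-< P∣N {{_}} {{>-nonZero N≥1}}) q≥1
      where
      q≥1 : 1 ≤ q
      q≥1 = n≢0⇒n>0 λ { refl → <⇒≱ N≥1 (≤-reflexive N≡qP) }
    ... | e , u , q≡ , P∤u = suc e , u , N≡ , P∤u
      where
      open ≡-Reasoning
      N≡ : N ≡ P ^ suc e * u
      N≡ = begin
        N                ≡⟨ N≡qP ⟩
        q * P            ≡⟨ cong (_* P) q≡ ⟩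
        P ^ e * u * P    ≡⟨ *-comm (P ^ e * u) P ⟩
        P * (P ^ e * u)  ≡⟨ *-assoc P (P ^ e) u ⟨
        P ^ suc e * u    ∎

  vℕ-unit : ∀ u → ¬ (P ∣ u) → vℕ P u ≡ 0
  vℕ-unit u P∤u = vℕ-exact 0 u u (sym (*-identityˡ u)) P∤u

  vℕ-P^ : ∀ e → vℕ P (P ^ e) ≡ e
  vℕ-P^ e = vℕ-exact e 1 (P ^ e) (sym (*-identityʳ (P ^ e))) P∤1

  -- Valuations add under multiplication (Euclid's lemma keeps P ∤ u₁u₂).
  vℕ-* : ∀ M N → 1 ≤ M → 1 ≤ N → vℕ P (M * N) ≡ vℕ P M + vℕ P N
  vℕ-* M N M≥1 N≥1 with split M M≥1 | split N N≥1
  ... | e₁ , u₁ , M≡ , P∤u₁ | e₂ , u₂ , N≡ , P∤u₂ =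
    trans (vℕ-exact (e₁ + e₂) (u₁ * u₂) (M * N) MN≡ P∤u₁u₂)
          (sym (cong₂ _+_ (vℕ-exact e₁ u₁ M M≡ P∤u₁) (vℕ-exact e₂ u₂ N N≡ P∤u₂)))
    where
    MN≡ : M * N ≡ P ^ (e₁ + e₂) * (u₁ * u₂)
    MN≡ = trans (cong₂ _*_ M≡ N≡)
            (trans ([m*n]*[o*p]≡[m*o]*[n*p] (P ^ e₁) u₁ (P ^ e₂) u₂)
                   (cong (_* (u₁ * u₂)) (sym (^-distribˡ-+-* P e₁ e₂))))
    P∤u₁u₂ : ¬ (P ∣ u₁ * u₂)
    P∤u₁u₂ P∣u₁u₂ with euclidsLemma u₁ u₂ prime-P P∣u₁u₂
    ... | inj₁ P∣u₁ = P∤u₁ P∣u₁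
    ... | inj₂ P∣u₂ = P∤u₂ P∣u₂

  -- vℕ P N < P^(vℕ P N) ≤ N.
  vℕ<self : ∀ N → 1 ≤ N → vℕ P N < N
  vℕ<self N N≥1 with split N N≥1
  ... | e , u , N≡ , P∤u = subst (_< N) (sym (vℕ-exact e u N N≡ P∤u))
    (≤-trans (e<P^e e) (≤-trans (m≤m*n (P ^ e) u {{>-nonZero (P∤⇒pos P∤u)}}) (≤-reflexive (sym N≡))))

  ∣⇔vℕ≥1 : ∀ N → 1 ≤ N → (P ∣ N ⇔ 1 ≤ vℕ P N)
  ∣⇔vℕ≥1 N N≥1 with split N N≥1
  ... | e , u , N≡ , P∤u rewrite vℕ-exact e u N N≡ P∤u = mk⇔ to from
    where
    to : P ∣ N → 1 ≤ e
    to P∣N = n≢0⇒n>0 λ { refl → P∤u (subst (P ∣_) (trans N≡ (*-identityˡ u)) P∣N) }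
    from : 1 ≤ e → P ∣ N
    from e≥1 = subst (P ∣_) (sym N≡) (P∣P^e* e u e≥1)

  vProgression : ℕ → ℕ → ℕ → ℕ
  vProgression a b m = sumTo m (λ j → vℕ P (a + j * b))

-- Positivity of the rationals entering the hypergeometric coefficient; it is
-- needed because valuations are only multiplicative away from 0.
ℕ→ℚ-nonNeg : ∀ j → NonNegative (ℕ→ℚ j)
ℕ→ℚ-nonNeg j = ℚP.normalize-nonNeg j 1

ℕ→ℚ-pos : ∀ m → Positive (ℕ→ℚ (suc m))
ℕ→ℚ-pos m = ℚP.normalize-pos (suc m) 1

ℕ→ℚ-normal : ∀ j → ℕ→ℚ j ≡ mkℚ (+ j) 0 (coprime-sym (1-coprimeTo j))
ℕ→ℚ-normal j = ℚP.normalize-coprime (coprime-sym (1-coprimeTo j))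

poch-pos : ∀ α → Positive α → ∀ m → Positive (poch α m)
poch-pos α α>0 zero    = _
poch-pos α α>0 (suc m) =
  ℚP.pos*pos⇒pos (poch α m) {{poch-pos α α>0 m}} (α ℚ.+ ℕ→ℚ m)
    {{ℚP.pos+nonNeg⇒pos α {{α>0}} (ℕ→ℚ m) {{ℕ→ℚ-nonNeg m}}}}

fact-pos : ∀ m → Positive (factℚ m)
fact-pos zero    = _
fact-pos (suc m) = ℚP.pos*pos⇒pos (factℚ m) {{fact-pos m}} (ℕ→ℚ (suc m)) {{ℕ→ℚ-pos m}}

prodFin-pos : ∀ {r} (f : Fin r → ℚ) → (∀ i → Positive (f i)) → Positive (prodFin f)
prodFin-pos {zero}  f f>0 = _
prodFin-pos {suc r} f f>0 =
  ℚP.pos*pos⇒pos (f zero) {{f>0 zero}} (prodFin (λ i → f (suc i))) {{prodFin-pos (λ i → f (suc i)) (λ i → f>0 (suc i))}}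

inv-pos : ∀ q → Positive q → Positive (inv q)
inv-pos q@(mkℚ +[1+ n ] d c) _ with q ℚP.≟ 0ℚ
... | no _ = _

pos⇒numerator≥1 : ∀ q → Positive q → 1 ≤ ∣ ↥ q ∣
pos⇒numerator≥1 (mkℚ +[1+ n ] d c) _ = s≤s z≤n

⊖-+-interchange : ∀ a b c d → (a + b) ⊖ (c + d) ≡ (a ⊖ c) ℤ.+ (b ⊖ d)
⊖-+-interchange a b c d = begin
  (a + b) ⊖ (c + d)                   ≡⟨ ℤP.[+m]-[+n]≡m⊖n (a + b) (c + d) ⟨
  + (a + b) ℤ.- + (c + d)             ≡⟨ cong₂ ℤ._-_ (ℤP.pos-+ a b) (ℤP.pos-+ c d) ⟩
  (+ a ℤ.+ + b) ℤ.- (+ c ℤ.+ + d)     ≡⟨ interchange (+ a) (+ b) (+ c) (+ d) ⟩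
  (+ a ℤ.- + c) ℤ.+ (+ b ℤ.- + d)     ≡⟨ cong₂ ℤ._+_ (ℤP.[+m]-[+n]≡m⊖n a c) (ℤP.[+m]-[+n]≡m⊖n b d) ⟩
  (a ⊖ c) ℤ.+ (b ⊖ d)                 ∎
  where
  open ≡-Reasoning
  open ℤ-Solver
  interchange : ∀ x y z w → (x ℤ.+ y) ℤ.- (z ℤ.+ w) ≡ (x ℤ.- z) ℤ.+ (y ℤ.- w)
  interchange = solve 4 (λ x y z w → (x :+ y) :- (z :+ w) := (x :- z) :+ (y :- w)) refl

module PAdicℚ (k : ℕ) (prime-P : Prime (suc (suc k))) where
  open PAdic k prime-P

  -- vℚ of an unreduced fraction i/n is v(|i|) - v(n): the gcd that is
  -- cancelled contributes equally to both.
  -- (N and D with equations let callers keep their own forms of |i| and n.)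
  vℚ-fraction : ∀ (i : ℤ) n .{{_ : NonZero n}} N D → ∣ i ∣ ≡ N → n ≡ D → 1 ≤ N →
                vℚ P (i ℚ./ n) ≡ vℕ P N ⊖ vℕ P D
  vℚ-fraction i n N D refl refl N≥1 = begin
    vℕ P ∣ ↥ q ∣ ⊖ vℕ P (↧ₙ q)                         ≡⟨ ℤP.+-cancelˡ-⊖ (vℕ P g) _ _ ⟨
    (vℕ P g + vℕ P ∣ ↥ q ∣) ⊖ (vℕ P g + vℕ P (↧ₙ q))   ≡⟨ cong₂ _⊖_ (+-comm (vℕ P g) _) (+-comm (vℕ P g) _) ⟩
    (vℕ P ∣ ↥ q ∣ + vℕ P g) ⊖ (vℕ P (↧ₙ q) + vℕ P g)   ≡⟨ cong₂ _⊖_ (vℕ-* ∣ ↥ q ∣ g num≥1 g≥1) (vℕ-* (↧ₙ q) g (s≤s z≤n) g≥1) ⟨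
    vℕ P (∣ ↥ q ∣ * g) ⊖ vℕ P (↧ₙ q * g)               ≡⟨ cong₂ (λ x y → vℕ P x ⊖ vℕ P y) num*g≡ den*g≡ ⟩
    vℕ P ∣ i ∣ ⊖ vℕ P n                                ∎
    where
    open ≡-Reasoning
    q = i ℚ./ n
    g = gcd ∣ i ∣ n
    num*g≡ : ∣ ↥ q ∣ * g ≡ ∣ i ∣
    num*g≡ = trans (sym (ℤP.abs-* (↥ q) (+ g))) (cong ∣_∣ (ℚP.↥-/ i n))
    den*g≡ : ↧ₙ q * g ≡ n
    den*g≡ = trans (sym (ℤP.abs-* (↧ q) (+ g))) (cong ∣_∣ (ℚP.↧-/ i n))
    num*g≥1 : 1 ≤ ∣ ↥ q ∣ * g
    num*g≥1 = subst (1 ≤_) (sym num*g≡) N≥1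
    num≥1 : 1 ≤ ∣ ↥ q ∣
    num≥1 = n≢0⇒n>0 λ num≡0 → <⇒≱ num*g≥1 (≤-reflexive (cong (_* g) num≡0))
    g≥1 : 1 ≤ g
    g≥1 = n≢0⇒n>0 λ g≡0 → <⇒≱ num*g≥1 (≤-reflexive (trans (cong (∣ ↥ q ∣ *_) g≡0) (*-zeroʳ ∣ ↥ q ∣)))

  vℚ-* : ∀ q₁ q₂ → Positive q₁ → Positive q₂ → vℚ P (q₁ ℚ.* q₂) ≡ vℚ P q₁ ℤ.+ vℚ P q₂
  vℚ-* q₁@(mkℚ _ _ _) q₂@(mkℚ _ _ _) q₁>0 q₂>0 = begin
    vℚ P (q₁ ℚ.* q₂)                                       ≡⟨ vℚ-fraction (↥ q₁ ℤ.* ↥ q₂) (↧ₙ q₁ * ↧ₙ q₂) _ _ (ℤP.abs-* (↥ q₁) (↥ q₂)) refl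
                                                                (*-mono-≤ (pos⇒numerator≥1 q₁ q₁>0) (pos⇒numerator≥1 q₂ q₂>0)) ⟩
    vℕ P (a₁ * a₂) ⊖ vℕ P (b₁ * b₂)                       ≡⟨ cong₂ _⊖_ (vℕ-* a₁ a₂ (pos⇒numerator≥1 q₁ q₁>0) (pos⇒numerator≥1 q₂ q₂>0))
                                                                       (vℕ-* b₁ b₂ (s≤s z≤n) (s≤s z≤n)) ⟩
    (vℕ P a₁ + vℕ P a₂) ⊖ (vℕ P b₁ + vℕ P b₂)             ≡⟨ ⊖-+-interchange (vℕ P a₁) (vℕ P a₂) (vℕ P b₁) (vℕ P b₂) ⟩
    vℚ P q₁ ℤ.+ vℚ P q₂                                    ∎
    where
    open ≡-Reasoning
    a₁ = ∣ ↥ q₁ ∣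
    a₂ = ∣ ↥ q₂ ∣
    b₁ = ↧ₙ q₁
    b₂ = ↧ₙ q₂

  vℚ-1 : vℚ P 1ℚ ≡ + 0
  vℚ-1 = cong (_⊖ vℕ P 1) (vℕ-P^ 0)

  vℚ-inv : ∀ q → Positive q → vℚ P (inv q) ≡ ℤ.- vℚ P q
  vℚ-inv q@(mkℚ +[1+ n ] d c) _ with q ℚP.≟ 0ℚ
  ... | no _ = ℤP.⊖-swap (vℕ P (suc d)) (vℕ P (suc n))

  vℚ-prodFin : ∀ {r} (f : Fin r → ℚ) (g : Fin r → ℕ) → (∀ i → Positive (f i)) →
               (∀ i → vℚ P (f i) ≡ + g i) → vℚ P (prodFin f) ≡ + sum g
  vℚ-prodFin {zero}  f g _   _    = vℚ-1
  vℚ-prodFin {suc r} f g f>0 vf≡g = begin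
    vℚ P (f zero ℚ.* prodFin (λ i → f (suc i)))              ≡⟨ vℚ-* (f zero) (prodFin (λ i → f (suc i))) (f>0 zero) (prodFin-pos _ (λ i → f>0 (suc i))) ⟩
    vℚ P (f zero) ℤ.+ vℚ P (prodFin (λ i → f (suc i)))       ≡⟨ cong₂ ℤ._+_ (vf≡g zero) (vℚ-prodFin _ _ (λ i → f>0 (suc i)) (λ i → vf≡g (suc i))) ⟩
    + g zero ℤ.+ + sum (λ i → g (suc i))                      ≡⟨ ℤP.pos-+ (g zero) _ ⟨
    + sum g                                                  ∎
    where open ≡-Reasoning

  vℚ-+ℕ : ∀ α → Positive α → ∀ j → vℚ P (α ℚ.+ ℕ→ℚ j) ≡ vℕ P (∣ ↥ α ∣ + j * ↧ₙ α) ⊖ vℕ P (↧ₙ α)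
  vℚ-+ℕ α@(mkℚ +[1+ a ] d c) _ j rewrite ℕ→ℚ-normal j =
    vℚ-fraction (+[1+ a ] ℤ.* + 1 ℤ.+ + j ℤ.* + suc d) (suc d * 1) _ _ numerator≡ (*-identityʳ (suc d)) (s≤s z≤n)
    where
    numerator≡ : ∣ +[1+ a ] ℤ.* + 1 ℤ.+ + j ℤ.* + suc d ∣ ≡ suc a + j * suc d
    numerator≡ = cong ∣_∣ (trans (cong₂ ℤ._+_ (ℤP.*-identityʳ +[1+ a ]) (sym (ℤP.pos-* j (suc d))))
                                 (sym (ℤP.pos-+ (suc a) (j * suc d))))

  vℚ-poch : ∀ α → Positive α → ¬ (P ∣ ↧ₙ α) → ∀ m → vℚ P (poch α m) ≡ + vProgression ∣ ↥ α ∣ (↧ₙ α) m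
  vℚ-poch α α>0 P∤b zero    = vℚ-1
  vℚ-poch α α>0 P∤b (suc m) = begin
    vℚ P (poch α m ℚ.* (α ℚ.+ ℕ→ℚ m))                      ≡⟨ vℚ-* (poch α m) (α ℚ.+ ℕ→ℚ m) (poch-pos α α>0 m) (ℚP.pos+nonNeg⇒pos α {{α>0}} (ℕ→ℚ m) {{ℕ→ℚ-nonNeg m}}) ⟩
    vℚ P (poch α m) ℤ.+ vℚ P (α ℚ.+ ℕ→ℚ m)                 ≡⟨ cong₂ ℤ._+_ (vℚ-poch α α>0 P∤b m) (vℚ-+ℕ α α>0 m) ⟩
    + vProgression a b m ℤ.+ (vℕ P (a + m * b) ⊖ vℕ P b)    ≡⟨ cong (λ x → + vProgression a b m ℤ.+ (vℕ P (a + m * b) ⊖ x)) (vℕ-unit b P∤b) ⟩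
    + vProgression a b m ℤ.+ + vℕ P (a + m * b)             ≡⟨ ℤP.pos-+ (vProgression a b m) _ ⟨
    + vProgression a b (suc m)                               ∎
    where
    open ≡-Reasoning
    a = ∣ ↥ α ∣
    b = ↧ₙ α

  vℚ-fact : ∀ m → vℚ P (factℚ m) ≡ + vProgression 1 1 m
  vℚ-fact zero    = vℚ-1
  vℚ-fact (suc m) = begin
    vℚ P (factℚ m ℚ.* ℕ→ℚ (suc m))                ≡⟨ vℚ-* (factℚ m) (ℕ→ℚ (suc m)) (fact-pos m) (ℕ→ℚ-pos m) ⟩
    vℚ P (factℚ m) ℤ.+ vℚ P (ℕ→ℚ (suc m))         ≡⟨ cong₂ ℤ._+_ (vℚ-fact m) vℚ-ℕ ⟩
    + vProgression 1 1 m ℤ.+ + vℕ P (1 + m * 1)   ≡⟨ ℤP.pos-+ (vProgression 1 1 m) _ ⟨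
    + vProgression 1 1 (suc m)                     ∎
    where
    open ≡-Reasoning
    vℚ-ℕ : vℚ P (ℕ→ℚ (suc m)) ≡ + vℕ P (1 + m * 1)
    vℚ-ℕ rewrite ℕ→ℚ-normal (suc m) | vℕ-P^ 0 | *-identityʳ m = refl

-- For P ∤ b, exactly one r < P makes P ∣ a + r b, so among
-- the first M·P terms of the progression a, a + b, a + 2b, … exactly every P-th
-- term is divisible by P, and dividing those by P gives the first M terms of a
-- new progression q, q + b, … .  Iterating K times:
--   ∑_{j < P^K} v(a + j b) = (1 + P + ⋯ + P^(K-1)) + v(a')   for some a' ≥ 1.
module Counting (k : ℕ) (prime-P : Prime (suc (suc k))) where
  open PAdic k prime-P

  instance
    P-nonZero : NonZero P
    P-nonZero = _

  geom : ℕ → ℕ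
  geom K = sumTo K (P ^_)

  coprime-P : ∀ b → ¬ (P ∣ b) → Coprime P b
  coprime-P b P∤b (d∣P , d∣b) with prime⇒irreducible prime-P d∣P
  ... | inj₁ d≡1  = d≡1
  ... | inj₂ refl = ⊥-elim (P∤b d∣b)

  inverse-mod : ∀ b → ¬ (P ∣ b) → Σ ℕ λ t → P ∣ 1 + t * b
  inverse-mod b P∤b with coprime-Bézout (coprime-P b P∤b)
  ... | Bézout.+- x y eq = y , divides x eq
  ... | Bézout.-+ x y eq = suc k * y , divides (1 + suc k * x) (begin
    1 + suc k * y * b         ≡⟨ cong suc (*-assoc (suc k) y b) ⟩
    1 + suc k * (y * b)       ≡⟨ cong (λ z → 1 + suc k * z) eq ⟨
    1 + suc k * (1 + x * P)   ≡⟨ solve 2 (λ k x → con 1 :+ (con 1 :+ k) :* (con 1 :+ x :* (con 2 :+ k))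
                                                := (con 1 :+ (con 1 :+ k) :* x) :* (con 2 :+ k)) refl k x ⟩
    (1 + suc k * x) * P       ∎)
    where
    open ≡-Reasoning
    open +-*-Solver

  -- Existence of the residue r < P with P ∣ a + r b: take r = a t mod P.
  residue : ∀ a b → ¬ (P ∣ b) → Σ ℕ λ r → r < P × P ∣ a + r * b
  residue a b P∤b with inverse-mod b P∤b
  ... | t , P∣1+tb = at % P , m%n<n (a * t) P , ∣m+n∣m⇒∣n P∣regrouped (∣m⇒∣m*n b (n∣m*n (at / P)))
    where
    open ≡-Reasoning
    open +-*-Solver
    at = a * t
    P∣term-at : P ∣ a + at * b
    P∣term-at = subst (P ∣_) (solve 3 (λ a t b → a :* (con 1 :+ t :* b) := a :+ a :* t :* b) refl a t b)
                 (∣n⇒∣m*n a P∣1+tb)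
    P∣regrouped : P ∣ at / P * P * b + (a + at % P * b)
    P∣regrouped = subst (P ∣_) (begin
      a + at * b                           ≡⟨ cong (λ z → a + z * b) (m≡m%n+[m/n]*n at P) ⟩
      a + (at % P + at / P * P) * b        ≡⟨ solve 5 (λ a r q p b → a :+ (r :+ q :* p) :* b := q :* p :* b :+ (a :+ r :* b))
                                                   refl a (at % P) (at / P) P b ⟩
      at / P * P * b + (a + at % P * b)    ∎) P∣term-at

  -- Two residues r < r' < P cannot both work: P would divide (r' - r) b.
  residue-gap : ∀ a b → ¬ (P ∣ b) → ∀ r r' → r < r' → r' < P →
                P ∣ a + r * b → P ∣ a + r' * b → ⊥
  residue-gap a b P∤b r r' r<r' r'<P P∣r P∣r'
    with euclidsLemma (r' ∸ r) b prime-P (∣m+n∣m⇒∣n (subst (P ∣_) split-r' P∣r') P∣r)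
    where
    open +-*-Solver
    split-r' : a + r' * b ≡ a + r * b + (r' ∸ r) * b
    split-r' = trans (cong (λ z → a + z * b) (sym (m+[n∸m]≡n (<⇒≤ r<r'))))
                     (solve 4 (λ a r d b → a :+ (r :+ d) :* b := a :+ r :* b :+ d :* b) refl a r (r' ∸ r) b)
  ... | inj₂ P∣b    = P∤b P∣b
  ... | inj₁ P∣r'-r = <-irrefl refl
          (≤-trans r'<P (≤-trans (∣⇒≤ {{>-nonZero (m<n⇒0<n∸m r<r')}} P∣r'-r) (m∸n≤m r' r)))

  residue-unique : ∀ a b → ¬ (P ∣ b) → ∀ r r' → r < P → r' < P →
                   P ∣ a + r * b → P ∣ a + r' * b → r ≡ r'
  residue-unique a b P∤b r r' r<P r'<P P∣r P∣r' with <-cmp r r'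
  ... | tri< r<r' _ _ = ⊥-elim (residue-gap a b P∤b r r' r<r' r'<P P∣r P∣r')
  ... | tri≈ _ r≡r' _ = r≡r'
  ... | tri> _ _ r'<r = ⊥-elim (residue-gap a b P∤b r' r r'<r r<P P∣r' P∣r)

  -- One step of the recursion: if a + r₀ b = q P with r₀ < P, then among the
  -- first M·P terms only those with index ≡ r₀ (mod P) are divisible by P,
  -- and the t-th of them equals P (q + t b).
  vProgression-descent : ∀ a b q r₀ M → 1 ≤ q → ¬ (P ∣ b) → r₀ < P → a + r₀ * b ≡ q * P →
            vProgression a b (M * P) ≡ M + vProgression q b M
  vProgression-descent a b q r₀ M q≥1 P∤b r₀<P a+r₀b≡qP = begin
    sumTo (M * P) f                                  ≡⟨ sumTo-blocks M P f ⟩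
    sumTo M (λ t → sumTo P (λ r → f (t * P + r)))    ≡⟨ sumTo-cong M (λ t _ → block t) ⟩
    sumTo M (λ t → suc (vℕ P (q + t * b)))           ≡⟨ sumTo-suc M (λ t → vℕ P (q + t * b)) ⟩
    M + vProgression q b M                           ∎
    where
    open ≡-Reasoning
    open +-*-Solver
    f : ℕ → ℕ
    f j = vℕ P (a + j * b)
    shift : ∀ t r → a + (t * P + r) * b ≡ t * b * P + (a + r * b)
    shift t r = solve 5 (λ a t p r b → a :+ (t :* p :+ r) :* b := t :* b :* p :+ (a :+ r :* b)) refl a t P r b
    block : ∀ t → sumTo P (λ r → f (t * P + r)) ≡ suc (vℕ P (q + t * b))
    block t = trans (sumTo-single P (λ r → f (t * P + r)) r₀ r₀<P off) on
      where
      off : ∀ r → r < P → r ≢ r₀ → f (t * P + r) ≡ 0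
      off r r<P r≢r₀ = vℕ-unit _ λ P∣ → r≢r₀ (residue-unique a b P∤b r r₀ r<P r₀<P
                         (∣m+n∣m⇒∣n (subst (P ∣_) (shift t r) P∣) (n∣m*n (t * b))) (divides q a+r₀b≡qP))
      term≡ : a + (t * P + r₀) * b ≡ P * (q + t * b)
      term≡ = begin
        a + (t * P + r₀) * b       ≡⟨ shift t r₀ ⟩
        t * b * P + (a + r₀ * b)   ≡⟨ cong (λ x → t * b * P + x) a+r₀b≡qP ⟩
        t * b * P + q * P          ≡⟨ solve 3 (λ q t p → t :* p :+ q :* p := p :* (q :+ t)) refl q (t * b) P ⟩
        P * (q + t * b)            ∎
      vℕ-P : vℕ P P ≡ 1
      vℕ-P = subst (λ x → vℕ P x ≡ 1) (*-identityʳ P) (vℕ-P^ 1)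
      on : f (t * P + r₀) ≡ suc (vℕ P (q + t * b))
      on = trans (cong (vℕ P) term≡)
             (trans (vℕ-* P (q + t * b) (s≤s z≤n) (≤-trans q≥1 (m≤m+n q (t * b))))
                    (cong (_+ vℕ P (q + t * b)) vℕ-P))

  quotient-pos : ∀ a b q r₀ → 1 ≤ a → a + r₀ * b ≡ q * P → 1 ≤ q
  quotient-pos a b q r₀ a≥1 a+r₀b≡qP =
    n≢0⇒n>0 λ { refl → <⇒≱ (≤-trans a≥1 (m≤m+n a (r₀ * b))) (≤-reflexive a+r₀b≡qP) }

  quotient-bound : ∀ a b q r₀ → r₀ < P → a + r₀ * b ≡ q * P → a ≤ b → q ≤ b
  quotient-bound a b q r₀ r₀<P a+r₀b≡qP a≤b = *-cancelʳ-≤ q b P (begin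
    q * P          ≡⟨ a+r₀b≡qP ⟨
    a + r₀ * b     ≤⟨ +-monoˡ-≤ (r₀ * b) a≤b ⟩
    suc r₀ * b     ≤⟨ *-monoˡ-≤ b r₀<P ⟩
    P * b          ≡⟨ *-comm P b ⟩
    b * P          ∎)
    where open ≤-Reasoning

  next-progression : ∀ a b → 1 ≤ a → ¬ (P ∣ b) →
                     Σ ℕ λ q → 1 ≤ q × (a ≤ b → q ≤ b) ×
                               (∀ M → vProgression a b (M * P) ≡ M + vProgression q b M)
  next-progression a b a≥1 P∤b = from-residue (residue a b P∤b)
    where
    from-residue : (Σ ℕ λ r → r < P × P ∣ a + r * b) →
                   Σ ℕ λ q → 1 ≤ q × (a ≤ b → q ≤ b) × (∀ M → vProgression a b (M * P) ≡ M + vProgression q b M)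
    from-residue (r₀ , r₀<P , divides q a+r₀b≡qP) =
      q , q≥1 , quotient-bound a b q r₀ r₀<P a+r₀b≡qP , λ M → vProgression-descent a b q r₀ M q≥1 P∤b r₀<P a+r₀b≡qP
      where
      q≥1 : 1 ≤ q
      q≥1 = quotient-pos a b q r₀ a≥1 a+r₀b≡qP

  vProgression-P^ : ∀ K a b → 1 ≤ a → ¬ (P ∣ b) →
                    Σ ℕ λ a' → 1 ≤ a' × (a ≤ b → a' ≤ b) × vProgression a b (P ^ K) ≡ geom K + vℕ P a'
  vProgression-P^ zero    a b a≥1 P∤b = a , a≥1 , id , cong (vℕ P) (+-identityʳ a)
  vProgression-P^ (suc K) a b a≥1 P∤b =
    let q  , q≥1  , a≤b⇒q≤b  , reduce = next-progression a b a≥1 P∤b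
        a' , a'≥1 , q≤b⇒a'≤b , IH     = vProgression-P^ K q b q≥1 P∤b
    in a' , a'≥1 , q≤b⇒a'≤b ∘ a≤b⇒q≤b , (begin
      vProgression a b (P * P ^ K)        ≡⟨ cong (vProgression a b) (*-comm P (P ^ K)) ⟩
      vProgression a b (P ^ K * P)        ≡⟨ reduce (P ^ K) ⟩
      P ^ K + vProgression q b (P ^ K)    ≡⟨ cong (λ x → P ^ K + x) IH ⟩
      P ^ K + (geom K + vℕ P a')          ≡⟨ +-assoc (P ^ K) (geom K) _ ⟨
      P ^ K + geom K + vℕ P a'            ≡⟨ cong (_+ vℕ P a') (+-comm (P ^ K) (geom K)) ⟩
      geom K + P ^ K + vℕ P a'            ∎)
    where open ≡-Reasoning

-- Writing x = a/b in lowest terms with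
-- 0 < a < b, goodness says v(b - a) = v(b) (the valuation of x - 1 is zero);
-- as gcd(a, b) = 1 this forces P ∤ b and P ∤ b - a.  The progression of x then
-- has no term divisible by P at the index P^K - 1, where a + (P^K - 1) b = P^K b - (b - a).
module Parameters (k : ℕ) (prime-P : Prime (suc (suc k))) where
  open PAdic k prime-P
  open PAdicℚ k prime-P
  open Counting k prime-P

  record GoodFraction (x : ℚ) : Set where
    field
      positive : Positive x
      num<den  : ∣ ↥ x ∣ < ↧ₙ x
      P∤den    : ¬ (P ∣ ↧ₙ x)
      P∤gap    : ¬ (P ∣ ↧ₙ x ∸ ∣ ↥ x ∣)

  goodFraction : ∀ x → Positive x → x ℚ.< 1ℚ → vℚ P (x ℚ.- 1ℚ) ≡ + 0 → GoodFraction x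
  goodFraction x@(mkℚ +[1+ a-1 ] b-1 coprime) x>0 (ℚ.*<* a*1<1*b) v[x-1]≡0 = record
    { positive = x>0
    ; num<den  = a<b
    ; P∤den    = λ P∣b → not-both P∣b (P∣b⇔P∣b-a .Equivalence.to P∣b)
    ; P∤gap    = λ P∣b-a → not-both (P∣b⇔P∣b-a .Equivalence.from P∣b-a) P∣b-a
    }
    where
    a = suc a-1
    b = suc b-1
    a<b : a < b
    a<b = ℤP.drop‿+<+ (subst₂ ℤ._<_ (ℤP.*-identityʳ (+ a)) (ℤP.*-identityˡ (+ b)) a*1<1*b)
    b-a≥1 : 1 ≤ b ∸ a
    b-a≥1 = m<n⇒0<n∸m a<b
    numerator≡ : ∣ +[1+ a-1 ] ℤ.* + 1 ℤ.+ -[1+ 0 ] ℤ.* + b ∣ ≡ b ∸ a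
    numerator≡ = trans (cong ∣_∣ (trans (cong₂ ℤ._+_ (ℤP.*-identityʳ (+ a)) (ℤP.-1*i≡-i (+ b))) (ℤP.m-n≡m⊖n a b)))
                       (ℤP.∣⊖∣-≤ (<⇒≤ a<b))
    v[b-a]≡v[b] : vℕ P (b ∸ a) ≡ vℕ P b
    v[b-a]≡v[b] = ℤP.+-injective (ℤP.i-j≡0⇒i≡j (+ _) (+ _) (begin
      + vℕ P (b ∸ a) ℤ.- + vℕ P b      ≡⟨ ℤP.[+m]-[+n]≡m⊖n (vℕ P (b ∸ a)) (vℕ P b) ⟩
      vℕ P (b ∸ a) ⊖ vℕ P b            ≡⟨ vℚ-fraction (+[1+ a-1 ] ℤ.* + 1 ℤ.+ -[1+ 0 ] ℤ.* + b) (b * 1) (b ∸ a) b numerator≡ (*-identityʳ b) b-a≥1 ⟨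
      vℚ P (x ℚ.- 1ℚ)                  ≡⟨ v[x-1]≡0 ⟩
      + 0                              ∎))
      where open ≡-Reasoning
    P∣b⇔P∣b-a : (P ∣ b) ⇔ (P ∣ b ∸ a)
    P∣b⇔P∣b-a = mk⇔
      (λ P∣b → ∣⇔vℕ≥1 (b ∸ a) b-a≥1 .Equivalence.from
                 (subst (1 ≤_) (sym v[b-a]≡v[b]) (∣⇔vℕ≥1 b (s≤s z≤n) .Equivalence.to P∣b)))
      (λ P∣b-a → ∣⇔vℕ≥1 b (s≤s z≤n) .Equivalence.from
                 (subst (1 ≤_) v[b-a]≡v[b] (∣⇔vℕ≥1 (b ∸ a) b-a≥1 .Equivalence.to P∣b-a)))
    -- P dividing both b and b - a would divide gcd(a, b) = 1.
    not-both : P ∣ b → P ∣ b ∸ a → ⊥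
    not-both P∣b P∣b-a = P≢1 (recompute-coprime coprime (P∣a , P∣b))
      where
      P∣a : P ∣ a
      P∣a = ∣m+n∣m⇒∣n (subst (P ∣_) (sym (m∸n+n≡m (<⇒≤ a<b))) P∣b) P∣b-a

  last : ℕ → ℕ
  last K = pred (P ^ K)

  suc-last : ∀ K → suc (last K) ≡ P ^ K
  suc-last K = suc-pred (P ^ K) {{m^n≢0 P K}}

  -- The term a + (P^K - 1) b equals P^K b - (b - a), so P does not divide it.
  P∤last-term : ∀ {x} → GoodFraction x → ∀ K → 1 ≤ K → ¬ (P ∣ ∣ ↥ x ∣ + last K * ↧ₙ x)
  P∤last-term {x} good K K≥1 P∣term = P∤gap (∣m+n∣m⇒∣n (subst (P ∣_) term+gap≡ (P∣P^e* K b K≥1)) P∣term)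
    where
    open GoodFraction good
    open ≡-Reasoning
    open +-*-Solver
    a = ∣ ↥ x ∣
    b = ↧ₙ x
    term+gap≡ : P ^ K * b ≡ a + last K * b + (b ∸ a)
    term+gap≡ = begin
      P ^ K * b                ≡⟨ cong (_* b) (suc-last K) ⟨
      b + last K * b           ≡⟨ cong (_+ last K * b) (m+[n∸m]≡n (<⇒≤ num<den)) ⟨
      a + (b ∸ a) + last K * b ≡⟨ solve 3 (λ a d sb → a :+ d :+ sb := a :+ sb :+ d) refl a (b ∸ a) (last K * b) ⟩
      a + last K * b + (b ∸ a) ∎

  window : ∀ {x} → GoodFraction x → ∀ K → 1 ≤ K →
           geom K ≤ vProgression ∣ ↥ x ∣ (↧ₙ x) (last K) × vProgression ∣ ↥ x ∣ (↧ₙ x) (last K) ≤ geom K + ↧ₙ x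
  window {x} good K K≥1
    with vProgression-P^ K ∣ ↥ x ∣ (↧ₙ x) (pos⇒numerator≥1 x (GoodFraction.positive good)) (GoodFraction.P∤den good)
  ... | a' , a'≥1 , a≤b⇒a'≤b , v≡ =
    ≤-trans (m≤m+n (geom K) _) (≤-reflexive (sym value)) ,
    ≤-trans (≤-reflexive value) (+-monoʳ-≤ (geom K) (<⇒≤ (≤-trans (vℕ<self a' a'≥1) (a≤b⇒a'≤b (<⇒≤ num<den)))))
    where
    open GoodFraction good
    open ≡-Reasoning
    a = ∣ ↥ x ∣
    b = ↧ₙ x
    value : vProgression a b (last K) ≡ geom K + vℕ P a'
    value = begin
      vProgression a b (last K)                               ≡⟨ +-identityʳ _ ⟨
      vProgression a b (last K) + 0                           ≡⟨ cong (λ n → vProgression a b (last K) + n) (vℕ-unit _ (P∤last-term good K K≥1)) ⟨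
      vProgression a b (last K) + vℕ P (a + last K * b)       ≡⟨ cong (vProgression a b) (suc-last K) ⟩
      vProgression a b (P ^ K)                                ≡⟨ v≡ ⟩
      geom K + vℕ P a'                                        ∎

  factorial-window : ∀ K → vProgression 1 1 (last K) + K ≡ geom K
  factorial-window K with vProgression-P^ K 1 1 (s≤s z≤n) P∤1
  ... | a' , a'≥1 , 1≤1⇒a'≤1 , v≡ with ≤-antisym (1≤1⇒a'≤1 ≤-refl) a'≥1
  ... | refl = begin
    vProgression 1 1 (last K) + K                       ≡⟨ cong (λ n → vProgression 1 1 (last K) + n) (vℕ-P^ K) ⟨
    vProgression 1 1 (last K) + vℕ P (P ^ K)            ≡⟨ cong (λ n → vProgression 1 1 (last K) + vℕ P n) 1+last≡ ⟨
    vProgression 1 1 (last K) + vℕ P (1 + last K * 1)   ≡⟨ cong (vProgression 1 1) (suc-last K) ⟩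
    vProgression 1 1 (P ^ K)                            ≡⟨ v≡ ⟩
    geom K + vℕ P 1                                     ≡⟨ cong (λ n → geom K + n) (vℕ-P^ 0) ⟩
    geom K + 0                                          ≡⟨ +-identityʳ (geom K) ⟩
    geom K                                              ∎
    where
    open ≡-Reasoning
    1+last≡ : 1 + last K * 1 ≡ P ^ K
    1+last≡ = trans (cong suc (*-identityʳ (last K))) (suc-last K)

module Coefficient (k : ℕ) (prime-P : Prime (suc (suc k))) where
  open PAdic k prime-P
  open PAdicℚ k prime-P
  open Counting k prime-P
  open Parameters k prime-P

  vParams : ∀ {n} → (Fin n → ℚ) → ℕ → ℕ
  vParams γ m = sum (λ i → vProgression ∣ ↥ γ i ∣ (↧ₙ γ i) m)

  prodPoch-pos : ∀ {n} (γ : Fin n → ℚ) → (∀ i → GoodFraction (γ i)) → ∀ m → Positive (prodFin (λ i → poch (γ i) m))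
  prodPoch-pos γ good m = prodFin-pos _ (λ i → poch-pos (γ i) (GoodFraction.positive (good i)) m)

  vℚ-prodPoch : ∀ {n} (γ : Fin n → ℚ) → (∀ i → GoodFraction (γ i)) → ∀ m →
                vℚ P (prodFin (λ i → poch (γ i) m)) ≡ + vParams γ m
  vℚ-prodPoch γ good m = vℚ-prodFin _ _ (λ i → poch-pos (γ i) (positive i) m)
                                         (λ i → vℚ-poch (γ i) (positive i) (P∤den i) m)
    where open module GoodAt i = GoodFraction (good i) using (positive; P∤den)

  vℚ-coeff : ∀ {r} (α : Fin (suc r) → ℚ) (β : Fin r → ℚ) →
             (∀ j → GoodFraction (α j)) → (∀ k → GoodFraction (β k)) → ∀ m →
             vℚ P (coeff α β m) ≡ + vParams α m ℤ.- (+ vParams β m ℤ.+ + vProgression 1 1 m)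
  vℚ-coeff α β goodα goodβ m = begin
    vℚ P (A ℚ.* inv (B ℚ.* F))                 ≡⟨ vℚ-* A (inv (B ℚ.* F)) (prodPoch-pos α goodα m) (inv-pos (B ℚ.* F) BF-pos) ⟩
    vℚ P A ℤ.+ vℚ P (inv (B ℚ.* F))            ≡⟨ cong (λ z → vℚ P A ℤ.+ z) (vℚ-inv (B ℚ.* F) BF-pos) ⟩
    vℚ P A ℤ.- vℚ P (B ℚ.* F)                  ≡⟨ cong (λ z → vℚ P A ℤ.- z) (vℚ-* B F (prodPoch-pos β goodβ m) (fact-pos m)) ⟩
    vℚ P A ℤ.- (vℚ P B ℤ.+ vℚ P F)             ≡⟨ cong₂ (λ x y → x ℤ.- y) (vℚ-prodPoch α goodα m)
                                                        (cong₂ ℤ._+_ (vℚ-prodPoch β goodβ m) (vℚ-fact m)) ⟩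
    + vParams α m ℤ.- (+ vParams β m ℤ.+ + vProgression 1 1 m) ∎
    where
    open ≡-Reasoning
    A = prodFin (λ j → poch (α j) m)
    B = prodFin (λ k → poch (β k) m)
    F = factℚ m
    BF-pos : Positive (B ℚ.* F)
    BF-pos = ℚP.pos*pos⇒pos B {{prodPoch-pos β goodβ m}} F {{fact-pos m}}

  valuation-grows : ∀ {r} (α : Fin (suc r) → ℚ) (β : Fin r → ℚ) →
                    (∀ j → GoodFraction (α j)) → (∀ k → GoodFraction (β k)) →
                    ∀ N K → N + sum (λ k → ↧ₙ β k) < K → + N ℤ.≤ vℚ P (coeff α β (last K))
  valuation-grows {r} α β goodα goodβ N K N+D<K =
    subst (+ N ℤ.≤_) (sym (vℚ-coeff α β goodα goodβ m))
      (subst (+ N ℤ.≤_) (sym difference≡) (ℤ.+≤+ (m+n≤o⇒m≤o∸n N N+[Y+Z]≤X)))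
    where
    K≥1 : 1 ≤ K
    K≥1 = ≤-trans (s≤s z≤n) N+D<K
    m = last K
    G = geom K
    X = vParams α m
    Y = vParams β m
    Z = vProgression 1 1 m
    D = sum (λ k → ↧ₙ β k)
    R = sum {r} (λ _ → G)
    G+R≤X : G + R ≤ X
    G+R≤X = sum-mono-≤ (λ _ → G) _ (λ j → proj₁ (window (goodα j) K K≥1))
    Y≤R+D : Y ≤ R + D
    Y≤R+D = ≤-trans (sum-mono-≤ _ (λ k → G + ↧ₙ β k) (λ k → proj₂ (window (goodβ k) K K≥1)))
                    (≤-reflexive (∑-distrib-+ (λ _ → G) (λ k → ↧ₙ β k)))
    N+[Y+Z]≤X : N + (Y + Z) ≤ X
    N+[Y+Z]≤X = begin
      N + (Y + Z)           ≤⟨ +-monoʳ-≤ N (+-monoˡ-≤ Z Y≤R+D) ⟩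
      N + (R + D + Z)       ≡⟨ solve 4 (λ n r d z → n :+ (r :+ d :+ z) := z :+ (n :+ d) :+ r) refl N R D Z ⟩
      Z + (N + D) + R       ≤⟨ +-monoˡ-≤ R (+-monoʳ-≤ Z (<⇒≤ N+D<K)) ⟩
      Z + K + R             ≡⟨ cong (_+ R) (factorial-window K) ⟩
      G + R                 ≤⟨ G+R≤X ⟩
      X                     ∎
      where
      open ≤-Reasoning
      open +-*-Solver
    difference≡ : + X ℤ.- (+ Y ℤ.+ + Z) ≡ + (X ∸ (Y + Z))
    difference≡ = trans (cong (λ z → + X ℤ.- z) (sym (ℤP.pos-+ Y Z)))
                        (trans (ℤP.m-n≡m⊖n X (Y + Z)) (ℤP.⊖-≥ (m+n≤o⇒n≤o N N+[Y+Z]≤X)))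

  good-parameters : ∀ {r} (α : Fin (suc r) → ℚ) (β : Fin r → ℚ) → Admissible α β → Good P α β →
                    (∀ j → GoodFraction (α j)) × (∀ k → GoodFraction (β k))
  good-parameters α β (α-range , β-range , _) (goodα , goodβ) =
    (λ j → fraction (α j) (α-range j) (goodα j)) , (λ k → fraction (β k) (β-range k) (goodβ k))
    where
    fraction : ∀ x → (0ℚ ℚ.< x) × (x ℚ.< 1ℚ) → vℚ P (x ℚ.- 1ℚ) ≡ + 0 → GoodFraction x
    fraction x (0<x , x<1) = goodFraction x (ℚ.positive 0<x) x<1

-- Every prime has the shape k + 2 on which `vℕ` computes.
prime⇒2+ : ∀ {p} → Prime p → Σ ℕ λ k → p ≡ suc (suc k)
prime⇒2+ {suc (suc k)} _ = k , refl
prime⇒2+ {0}     prime-p = ⊥-elim (<⇒≱ (nonTrivial⇒n>1 0 {{prime⇒nonTrivial prime-p}}) z≤n)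
prime⇒2+ {1}     prime-p = ⊥-elim (<-irrefl refl (nonTrivial⇒n>1 1 {{prime⇒nonTrivial prime-p}}))

vℚ-large-prime : ∀ p → Prime p → ∀ q → ∣ ↥ q ∣ < p → ↧ₙ q < p → vℚ p q ≡ + 0
vℚ-large-prime p prime-p q num<p den<p with prime⇒2+ prime-p
... | k , refl = cong₂ _⊖_ (vℕ-below ∣ ↥ q ∣ num<p) (vℕ-below (↧ₙ q) den<p)
  where
  open PAdic k prime-p
  vℕ-below : ∀ n → n < P → vℕ P n ≡ 0
  vℕ-below zero    _   = refl
  vℕ-below (suc n) n<P = vℕ-unit (suc n) λ P∣n → <⇒≱ n<P (∣⇒≤ P∣n)

large-primes-good : ∀ {r} (α : Fin (suc r) → ℚ) (β : Fin r → ℚ) →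
                    ∃[ B ] (∀ p → Prime p → B ≤ p → Good p α β)
large-primes-good α β = suc (Hα + Hβ) , λ p prime-p B≤p →
  (λ j → good-at p prime-p (α j) (≤-trans (s≤s (≤-trans (≤-sum (height ∘ α) j) (m≤m+n Hα Hβ))) B≤p)) ,
  (λ k → good-at p prime-p (β k) (≤-trans (s≤s (≤-trans (≤-sum (height ∘ β) k) (m≤n+m Hβ Hα))) B≤p))
  where
  height : ℚ → ℕ
  height x = ∣ ↥ (x ℚ.- 1ℚ) ∣ + ↧ₙ (x ℚ.- 1ℚ)
  Hα = sum (height ∘ α)
  Hβ = sum (height ∘ β)
  good-at : ∀ p → Prime p → ∀ x → height x < p → vℚ p (x ℚ.- 1ℚ) ≡ + 0
  good-at p prime-p x h<p = vℚ-large-prime p prime-p (x ℚ.- 1ℚ)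
    (≤-trans (s≤s (m≤m+n _ _)) h<p) (≤-trans (s≤s (m≤n+m _ _)) h<p)

unbounded-at-good-primes :
  ∀ (r : ℕ) (α : Fin (suc r) → ℚ) (β : Fin r → ℚ) → Admissible α β →
  ∀ (p : ℕ) → Prime p → Good p α β →
  ∀ (N : ℕ) → ∃[ m ] (+ N ℤ.≤ vℚ p (coeff α β m))
unbounded-at-good-primes r α β admissible p prime-p good N with prime⇒2+ prime-p
... | k , refl = last K , valuation-grows α β goodα goodβ N K ≤-refl
  where
  open Parameters k prime-p using (last)
  open Coefficient k prime-p
  K = suc (N + sum (λ k → ↧ₙ β k))
  goodα = proj₁ (good-parameters α β admissible good)
  goodβ = proj₂ (good-parameters α β admissible good)

proposition3p7 :
    (∀ (r : ℕ) (α : Fin (suc r) → ℚ) (β : Fin r → ℚ) → Admissible α β →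
      ∀ (p : ℕ) → Prime p → Good p α β →
      ∀ (N : ℕ) → ∃[ m ] (+ N ℤ.≤ vℚ p (coeff α β m)))
    ×
    (∀ (r : ℕ) (α : Fin (suc r) → ℚ) (β : Fin r → ℚ) → Admissible α β →
      ∃[ B ] (∀ (p : ℕ) → Prime p → B ≤ p →
        ∀ (N : ℕ) → ∃[ m ] (+ N ℤ.≤ vℚ p (coeff α β m))))
proposition3p7 = unbounded-at-good-primes , λ r α β admissible →
  let (B , large⇒good) = large-primes-good α β in
  B , λ p prime-p B≤p → unbounded-at-good-primes r α β admissible p prime-p (large⇒good p prime-p B≤p)
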